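{- Let $n\geq 2k+1$. For any $x\in X_{n,k}$, the sequence $C(x)=(x,f(x),f^2(x),\ldots)$, obtained by repeatedly applying $f$ to $x$ until $x$ is obtained again, describes a cycle of length at least $3$ in the Kneser graph $K(n,k)$.
   Context: $X_{n,k}$ is the set of binary strings of length $n$ with exactly $k$ ones; such a string is identified with the $k$-subset of $[n]$ of positions of its ones, so $X_{n,k}$ is the vertex set of the Kneser graph $K(n,k)$ (vertices adjacent iff the corresponding sets are disjoint, i.e. the strings have no $1$ in a common position). Parenthesis matching: regard $x$ as a cyclic string (indices modulo $n$); each $1$ is matched to the last $0$ of the shortest cyclic substring starting at this $1$ and extending to the right that contains equally many $0$s and $1$s. Since $n\geq 2k+1$, every $1$ is matched to a distinct $0$ and $n-2k$ zeros remain unmatched. $f(x)\in X_{n,k}$ is the string obtained from $x$ by complementing all matched bits (matched $1$s and matched $0$s), leaving unmatched $0$s unchanged. -}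

module Defs where

open import Data.Bool using (Bool; true; false; if_then_else_; _∨_)
open import Data.Nat using (ℕ; zero; suc; _+_; _≡ᵇ_)
open import Relation.Binary.PropositionalEquality using (_≡_)
open import Data.Nat.DivMod using (_mod_)
open import Data.Maybe using (Maybe; just; nothing; is-just)
open import Data.Fin using (Fin; toℕ)
open import Data.Fin.Subset using (Subset; _∩_; Empty; ∣_∣)
open import Data.Vec using (Vec; lookup; tabulate; foldr)
open import Data.Fin.Properties using (_≟_)
open import Relation.Nullary.Decidable using (⌊_⌋)

-- Binary strings of length n are subsets of Fin n (Vec Bool n); a 1 is 'true'.
-- X_{n,k} : strings with exactly k ones.
InX : (n k : ℕ) → Subset n → Set
InX n k x = ∣ x ∣ ≡ k

Adjacent : {n : ℕ} → Subset n → Subset n → Set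
Adjacent x y = Empty (x ∩ y)

bitAt : {n : ℕ} → Vec Bool n → ℕ → Bool
bitAt {zero}  x m = false
bitAt {suc n} x m = lookup x (m mod (suc n))

onesIn : {n : ℕ} → Vec Bool n → ℕ → ℕ → ℕ
onesIn x i zero    = if bitAt x i then 1 else 0
onesIn x i (suc m) = onesIn x i m + (if bitAt x (i + suc m) then 1 else 0)

zerosIn : {n : ℕ} → Vec Bool n → ℕ → ℕ → ℕ
zerosIn x i zero    = if bitAt x i then 0 else 1
zerosIn x i (suc m) = zerosIn x i m + (if bitAt x (i + suc m) then 0 else 1)

searchBal : {n : ℕ} → Vec Bool n → ℕ → (fuel m0 : ℕ) → Maybe ℕ
searchBal x i zero       m0 = nothing
searchBal x i (suc fuel) m0 =
  if onesIn x i m0 ≡ᵇ zerosIn x i m0 then just m0 else searchBal x i fuel (suc m0)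

-- For a 1 at position i: the length-minus-one m of the shortest cyclic
-- substring starting at i (to the right) with equally many 0s and 1s.
-- (Lengths beyond n need not be searched: any such substring has length ≤ n
-- when it exists at all with n ≥ 2k+1; we search m < n.)
matchLen : {n : ℕ} → Vec Bool n → Fin n → Maybe ℕ
matchLen {n} x i = searchBal x (toℕ i) n 0

matchedTo : {n : ℕ} → Vec Bool n → Fin n → Fin n → Bool
matchedTo {zero}  x i j = false
matchedTo {suc n} x i j with lookup x i | matchLen x i
... | true  | just m  = ⌊ ((toℕ i + m) mod (suc n)) ≟ j ⌋
... | _     | _       = false

matched0 : {n : ℕ} → Vec Bool n → Fin n → Bool
matched0 {n} x j = foldr (λ _ → Bool) _∨_ false (tabulate (λ i → matchedTo x i j))

-- f: complement all matched bits (matched 1s and matched 0s)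
f : {n : ℕ} → Subset n → Subset n
f x = tabulate λ j →
  if lookup x j
    then (if is-just (matchLen x j) then false else true)
    else matched0 x j

iter : {A : Set} → (A → A) → ℕ → A → A
iter g zero    a = a
iter g (suc p) a = g (iter g p a)

{-# OPTIONS --safe #-}

-- Read x cyclically as a walk S on ℤ that steps up at a 1 and down at a 0; one period
-- changes the level by S N = 2k − N < 0. A 1 at t is matched to the 0 at which the walk
-- first returns to the level S t, and a 0 at J is matched exactly when, somewhere in the
-- preceding period, the walk is at or below the level S (J + 1) reached just after it.
-- So the unmatched zeros are the steps at which the minimum of S over a sliding window
-- of one period drops; there are −S N = N − 2k of them, and f x again has k ones.
-- In the walk T of f x, T + S is constant from a 1 of x up to its match, whereas after
-- an unmatched zero T stays below its starting level for a whole period; hence x can be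
-- read off f x, f is injective on X_{n,k}, and its orbits are cycles. Consecutive strings
-- are disjoint, so f x ≢ x, and f (f x) ≢ x is witnessed by a matched zero of x followed
-- by an unmatched one.
module Submission where

open import Defs
open import Data.Bool using (Bool; true; false; if_then_else_; not; _∧_; _∨_)
open import Data.Bool.Properties using (¬-not)
open import Data.Nat as ℕ using (ℕ; zero; suc; _+_; _*_; _∸_; _^_; _≡ᵇ_; _%_; _/_; _≤_; _<_; _≥_; z≤n; s≤s)
import Data.Nat.Properties as ℕ
open import Data.Nat.DivMod using (_mod_; m<n⇒m%n≡m; [m+kn]%n≡m%n; [m+n]%n≡m%n; m≡m%n+[m/n]*n; /-mono-≤)
open import Data.Fin using (Fin; toℕ; funToFin; finToFun) renaming (zero to fzero; suc to fsuc)
open import Data.Fin.Properties using (toℕ-fromℕ<; fromℕ<-cong; fromℕ<-toℕ; toℕ<n; pigeonhole; finToFun-funToFin)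
  renaming (_≟_ to _≟ᶠ_)
open import Data.Fin.Subset using (Subset; ∣_∣; _∩_; Empty)
open import Data.Fin.Subset.Properties using (∩-idem; Empty-unique; ∣⊥∣≡0)
open import Data.Vec using (Vec; []; _∷_; lookup; tabulate; foldr)
open import Data.Vec.Properties using (lookup∘tabulate; tabulate∘lookup; tabulate-cong; []=⇒lookup; lookup-zipWith)
open import Data.Maybe using (just; nothing; is-just)
open import Data.Integer as ℤ using (ℤ; 0ℤ; 1ℤ; -1ℤ) renaming (+_ to pos; suc to sucℤ; pred to predℤ)
import Data.Integer.Properties as ℤ
open import Algebra.Properties.AbelianGroup ℤ.+-0-abelianGroup using (∙-cancelˡ; ∙-cancelʳ)
import Algebra.Properties.CommutativeSemigroup as CommSemigroupProperties
open import Data.Product using (∃; _×_; _,_; proj₁; proj₂)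
open import Data.Sum using (inj₁; inj₂)
open import Data.Empty using (⊥-elim)
open import Relation.Nullary using (¬_; Dec; yes; no)
open import Relation.Unary using (Decidable)
open import Relation.Binary.PropositionalEquality
open import Relation.Binary.Definitions using (tri<; tri≈; tri>)

private
  module ℕ+ = CommSemigroupProperties ℕ.+-commutativeSemigroup
  module ℤ+ = CommSemigroupProperties ℤ.+-commutativeSemigroup

  true≢false : true ≢ false
  true≢false ()

-- Walks with steps ±1

step : Bool → ℤ → ℤ
step true  = sucℤ
step false = predℤ

height : (ℕ → Bool) → ℕ → ℤ
height g zero    = 0ℤ
height g (suc t) = step (g t) (height g t)

step-+ : ∀ c a d → step c (a ℤ.+ d) ≡ step c a ℤ.+ d
step-+ true  a d = sym (ℤ.+-assoc 1ℤ a d)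
step-+ false a d = sym (ℤ.+-assoc -1ℤ a d)

i<suc[i] : ∀ i → i ℤ.< sucℤ i
i<suc[i] i = ℤ.suc[i]≤j⇒i<j ℤ.≤-refl

pred[i]<i : ∀ i → predℤ i ℤ.< i
pred[i]<i i = ℤ.i≤pred[j]⇒i<j ℤ.≤-refl

step-crosses-down : ∀ c {v w} → v ℤ.< w → step c w ℤ.≤ v → step c w ≡ v
step-crosses-down true  v<w sw≤v =
  ⊥-elim (ℤ.<-irrefl refl (ℤ.<-≤-trans (ℤ.<-trans v<w (i<suc[i] _)) sw≤v))
step-crosses-down false v<w pw≤v = ℤ.≤-antisym pw≤v (ℤ.i<j⇒i≤pred[j] v<w)

step-crosses-up : ∀ c {v w} → w ℤ.≤ v → v ℤ.< step c w → c ≡ true × w ≡ v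
step-crosses-up true  {v} {w} w≤v v<sw =
  refl , ℤ.≤-antisym w≤v (subst (v ℤ.≤_) (ℤ.pred-suc w) (ℤ.i<j⇒i≤pred[j] v<sw))
step-crosses-up false w≤v v<pw =
  ⊥-elim (ℤ.<-irrefl refl (ℤ.<-≤-trans (ℤ.<-trans v<pw (pred[i]<i _)) w≤v))

step-count : ∀ c a → step c a ℤ.+ pos (if c then 0 else 1) ≡ a ℤ.+ pos (if c then 1 else 0)
step-count true  a = trans (ℤ.+-identityʳ (sucℤ a)) (ℤ.+-comm (pos 1) a)
step-count false a = begin
  predℤ a ℤ.+ pos 1     ≡⟨ ℤ.pred-+ a (pos 1) ⟩
  predℤ (a ℤ.+ pos 1)   ≡⟨ cong predℤ (ℤ.+-comm a (pos 1)) ⟩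
  predℤ (sucℤ a)        ≡⟨ ℤ.pred-suc a ⟩
  a                     ≡⟨ ℤ.+-identityʳ a ⟨
  a ℤ.+ pos 0           ∎
  where open ≡-Reasoning

step-complement : ∀ c u v → step (not c) u ℤ.+ step c v ≡ u ℤ.+ v
step-complement true  u v = begin
  predℤ u ℤ.+ (1ℤ ℤ.+ v)    ≡⟨ ℤ.pred-+ u (1ℤ ℤ.+ v) ⟩
  predℤ (u ℤ.+ (1ℤ ℤ.+ v))  ≡⟨ cong predℤ (ℤ+.x∙yz≈y∙xz u 1ℤ v) ⟩
  predℤ (sucℤ (u ℤ.+ v))    ≡⟨ ℤ.pred-suc (u ℤ.+ v) ⟩
  u ℤ.+ v                   ∎
  where open ≡-Reasoning
step-complement false u v = begin
  (1ℤ ℤ.+ u) ℤ.+ predℤ v    ≡⟨ ℤ.+-pred (1ℤ ℤ.+ u) v ⟩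
  predℤ ((1ℤ ℤ.+ u) ℤ.+ v)  ≡⟨ cong predℤ (ℤ.+-assoc 1ℤ u v) ⟩
  predℤ (sucℤ (u ℤ.+ v))    ≡⟨ ℤ.pred-suc (u ℤ.+ v) ⟩
  u ℤ.+ v                   ∎
  where open ≡-Reasoning

height-complementary : ∀ g g′ a d → (∀ s → a ≤ s → s < a + d → g′ s ≡ not (g s)) →
  height g′ (a + d) ℤ.+ height g (a + d) ≡ height g′ a ℤ.+ height g a
height-complementary g g′ a zero    _    = cong (λ t → height g′ t ℤ.+ height g t) (ℕ.+-identityʳ a)
height-complementary g g′ a (suc d) comp = begin
  height g′ (a + suc d) ℤ.+ height g (a + suc d)
    ≡⟨ cong (λ t → height g′ t ℤ.+ height g t) (ℕ.+-suc a d) ⟩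
  step (g′ (a + d)) (height g′ (a + d)) ℤ.+ step (g (a + d)) (height g (a + d))
    ≡⟨ cong (λ c → step c (height g′ (a + d)) ℤ.+ step (g (a + d)) (height g (a + d)))
            (comp (a + d) (ℕ.m≤m+n a d) (ℕ.+-monoʳ-< a (ℕ.n<1+n d))) ⟩
  step (not (g (a + d))) (height g′ (a + d)) ℤ.+ step (g (a + d)) (height g (a + d))
    ≡⟨ step-complement (g (a + d)) _ _ ⟩
  height g′ (a + d) ℤ.+ height g (a + d)
    ≡⟨ height-complementary g g′ a d (λ s a≤s s<a+d → comp s a≤s (ℕ.<-trans s<a+d (ℕ.+-monoʳ-< a (ℕ.n<1+n d)))) ⟩
  height g′ a ℤ.+ height g a ∎
  where open ≡-Reasoning

module Walk (g : ℕ → Bool) where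

  private
    h : ℕ → ℤ
    h = height g

  first-descent : ∀ a d v → v ℤ.< h a → h (a + d) ℤ.≤ v →
    ∃ λ e → a < e × e ≤ a + d × h e ≡ v × (∀ s → a ≤ s → s < e → v ℤ.< h s)
  first-descent a zero v v<ha had≤v =
    ⊥-elim (ℤ.<-irrefl refl (ℤ.<-≤-trans v<ha (subst (λ t → h t ℤ.≤ v) (ℕ.+-identityʳ a) had≤v)))
  first-descent a (suc d) v v<ha had≤v with h (suc a) ℤ.≤? v
  ... | yes h1≤v =
    suc a , ℕ.≤-refl , subst (suc a ≤_) (sym (ℕ.+-suc a d)) (ℕ.s≤s (ℕ.m≤m+n a d)) ,
    step-crosses-down (g a) v<ha h1≤v ,
    λ s a≤s s<1+a → subst (λ t → v ℤ.< h t) (ℕ.≤-antisym a≤s (ℕ.s≤s⁻¹ s<1+a)) v<ha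
  ... | no h1≰v with first-descent (suc a) d v (ℤ.≰⇒> h1≰v) (subst (λ t → h t ℤ.≤ v) (ℕ.+-suc a d) had≤v)
  ... | e , 1+a<e , e≤ , he≡v , above = e , ℕ.<-trans (ℕ.n<1+n a) 1+a<e ,
        subst (e ≤_) (sym (ℕ.+-suc a d)) e≤ , he≡v , above′
    where
    above′ : ∀ s → a ≤ s → s < e → v ℤ.< h s
    above′ s a≤s s<e with ℕ.m≤n⇒m<n∨m≡n a≤s
    ... | inj₁ a<s  = above s a<s s<e
    ... | inj₂ refl = v<ha

  last-ascent : ∀ s d v → h s ℤ.≤ v → v ℤ.< h (s + d) →
    ∃ λ s′ → s ≤ s′ × s′ < s + d × h s′ ≡ v × (∀ t → s′ < t → t ≤ s + d → v ℤ.< h t)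
  last-ascent s zero v hs≤v v<hsd =
    ⊥-elim (ℤ.<-irrefl refl (ℤ.<-≤-trans v<hsd (subst (λ t → h t ℤ.≤ v) (sym (ℕ.+-identityʳ s)) hs≤v)))
  last-ascent s (suc d) v hs≤v v<hsd with h (s + d) ℤ.≤? v
  ... | yes hsd≤v = s + d , ℕ.m≤m+n s d , s+d<s+1+d , proj₂ (step-crosses-up (g (s + d)) hsd≤v v<h1) , above
    where
    s+d<s+1+d : s + d < s + suc d
    s+d<s+1+d = ℕ.+-monoʳ-< s (ℕ.n<1+n d)
    v<h1 : v ℤ.< step (g (s + d)) (h (s + d))
    v<h1 = subst (λ t → v ℤ.< h t) (ℕ.+-suc s d) v<hsd
    above : ∀ t → s + d < t → t ≤ s + suc d → v ℤ.< h t
    above t lt le = subst (λ t → v ℤ.< h t) (ℕ.≤-antisym (subst (_≤ t) (sym (ℕ.+-suc s d)) lt) le) v<hsd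
  ... | no hsd≰v with last-ascent s d v hs≤v (ℤ.≰⇒> hsd≰v)
  ... | s′ , s≤s′ , s′< , hs′≡v , above = s′ , s≤s′ , ℕ.<-trans s′< (ℕ.+-monoʳ-< s (ℕ.n<1+n d)) , hs′≡v , above′
    where
    above′ : ∀ t → s′ < t → t ≤ s + suc d → v ℤ.< h t
    above′ t lt le with ℕ.m≤n⇒m<n∨m≡n le
    ... | inj₂ refl = v<hsd
    ... | inj₁ t<   = above t lt (ℕ.s≤s⁻¹ (subst (t <_) (ℕ.+-suc s d) t<))

module RangeMin (h : ℕ → ℤ) where

  rangeMin : ℕ → ℕ → ℤ
  rangeMin a zero    = h a
  rangeMin a (suc L) = rangeMin a L ℤ.⊓ h (a + suc L)

  rangeMin-≤ : ∀ a L l → l ≤ L → rangeMin a L ℤ.≤ h (a + l)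
  rangeMin-≤ a zero    .zero z≤n = ℤ.≤-reflexive (cong h (sym (ℕ.+-identityʳ a)))
  rangeMin-≤ a (suc L) l l≤1+L with ℕ.m≤n⇒m<n∨m≡n l≤1+L
  ... | inj₂ refl = ℤ.i⊓j≤j _ _
  ... | inj₁ l<1+L = ℤ.≤-trans (ℤ.i⊓j≤i _ _) (rangeMin-≤ a L l (ℕ.s≤s⁻¹ l<1+L))

  rangeMin-attained : ∀ a L → ∃ λ l → l ≤ L × rangeMin a L ≡ h (a + l)
  rangeMin-attained a zero = 0 , z≤n , cong h (sym (ℕ.+-identityʳ a))
  rangeMin-attained a (suc L) with ℤ.⊓-sel (rangeMin a L) (h (a + suc L))
  ... | inj₂ min≡last = suc L , ℕ.≤-refl , min≡last
  ... | inj₁ min≡prev with rangeMin-attained a L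
  ...   | l , l≤L , eq = l , ℕ.m≤n⇒m≤1+n l≤L , trans min≡prev eq

  rangeMin-unique : ∀ a L u → (∀ l → l ≤ L → u ℤ.≤ h (a + l)) → (∃ λ l → l ≤ L × u ≡ h (a + l)) →
    u ≡ rangeMin a L
  rangeMin-unique a L u lower (l , l≤L , u≡) with rangeMin-attained a L
  ... | l′ , l′≤L , min≡ = ℤ.≤-antisym (subst (u ℤ.≤_) (sym min≡) (lower l′ l′≤L))
                                      (subst (rangeMin a L ℤ.≤_) (sym u≡) (rangeMin-≤ a L l l≤L))

+-cancelʳ-≤ : ∀ {a b} c → a ℤ.+ c ℤ.≤ b ℤ.+ c → a ℤ.≤ b
+-cancelʳ-≤ {a} {b} c a+c≤b+c = subst₂ ℤ._≤_ (cancel a) (cancel b) (ℤ.+-monoˡ-≤ (ℤ.- c) a+c≤b+c)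
  where
  cancel : ∀ u → u ℤ.+ c ℤ.+ ℤ.- c ≡ u
  cancel u = trans (ℤ.+-assoc u c (ℤ.- c)) (trans (cong (λ w → u ℤ.+ w) (ℤ.+-inverseʳ c)) (ℤ.+-identityʳ u))

pred-+-pred-+ : ∀ u v w → predℤ u ℤ.+ predℤ v ℤ.+ w ≡ predℤ (predℤ (u ℤ.+ v ℤ.+ w))
pred-+-pred-+ u v w = begin
  predℤ u ℤ.+ predℤ v ℤ.+ w            ≡⟨ cong (ℤ._+ w) (ℤ.pred-+ u (predℤ v)) ⟩
  predℤ (u ℤ.+ predℤ v) ℤ.+ w          ≡⟨ ℤ.pred-+ (u ℤ.+ predℤ v) w ⟩
  predℤ (u ℤ.+ predℤ v ℤ.+ w)          ≡⟨ cong (λ r → predℤ (r ℤ.+ w)) (ℤ.+-pred u v) ⟩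
  predℤ (predℤ (u ℤ.+ v) ℤ.+ w)        ≡⟨ cong predℤ (ℤ.pred-+ (u ℤ.+ v) w) ⟩
  predℤ (predℤ (u ℤ.+ v ℤ.+ w))        ∎
  where open ≡-Reasoning

+-pred-+-pred : ∀ u m → u ℤ.+ (predℤ m ℤ.+ predℤ m) ≡ predℤ (predℤ (u ℤ.+ (m ℤ.+ m)))
+-pred-+-pred u m = begin
  u ℤ.+ (predℤ m ℤ.+ predℤ m)          ≡⟨ cong (λ r → u ℤ.+ r) (ℤ.pred-+ m (predℤ m)) ⟩
  u ℤ.+ predℤ (m ℤ.+ predℤ m)          ≡⟨ ℤ.+-pred u (m ℤ.+ predℤ m) ⟩
  predℤ (u ℤ.+ (m ℤ.+ predℤ m))        ≡⟨ cong (λ r → predℤ (u ℤ.+ r)) (ℤ.+-pred m m) ⟩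
  predℤ (u ℤ.+ predℤ (m ℤ.+ m))        ≡⟨ cong predℤ (ℤ.+-pred u (m ℤ.+ m)) ⟩
  predℤ (predℤ (u ℤ.+ (m ℤ.+ m)))      ∎
  where open ≡-Reasoning

indicator : Bool → ℕ
indicator c = if c then 1 else 0

countTrue : (ℕ → Bool) → ℕ → ℕ
countTrue g zero    = 0
countTrue g (suc L) = countTrue g L + indicator (g L)

countTrue-suc : ∀ g L → countTrue g (suc L) ≡ indicator (g 0) + countTrue (λ t → g (suc t)) L
countTrue-suc g zero    = ℕ.+-comm 0 (indicator (g 0))
countTrue-suc g (suc L) = trans (cong (_+ indicator (g (suc L))) (countTrue-suc g L))
                                (ℕ.+-assoc (indicator (g 0)) _ _)

countTrue-cong : ∀ {g h} → (∀ t → g t ≡ h t) → ∀ L → countTrue g L ≡ countTrue h L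
countTrue-cong g≡h zero    = refl
countTrue-cong g≡h (suc L) = cong₂ _+_ (countTrue-cong g≡h L) (cong indicator (g≡h L))

countTrue-shift : ∀ g N → (∀ t → g (t + N) ≡ g t) → ∀ a → countTrue (λ t → g (a + t)) N ≡ countTrue g N
countTrue-shift g N periodic zero    = refl
countTrue-shift g N periodic (suc a) = ℕ.+-cancelˡ-≡ (indicator (g a)) _ _ (begin
  indicator (g a) + countTrue (λ t → g (suc a + t)) N
    ≡⟨ cong (indicator (g a) +_) (countTrue-cong (λ t → cong g (sym (ℕ.+-suc a t))) N) ⟩
  indicator (g a) + countTrue (λ t → g (a + suc t)) N
    ≡⟨ cong (λ c → indicator (g c) + countTrue (λ t → g (a + suc t)) N) (ℕ.+-identityʳ a) ⟨
  indicator (g (a + 0)) + countTrue (λ t → g (a + suc t)) N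
    ≡⟨ countTrue-suc (λ t → g (a + t)) N ⟨
  countTrue (λ t → g (a + t)) N + indicator (g (a + N))
    ≡⟨ cong₂ _+_ (countTrue-shift g N periodic a) (cong indicator (periodic a)) ⟩
  countTrue g N + indicator (g a)
    ≡⟨ ℕ.+-comm (countTrue g N) (indicator (g a)) ⟩
  indicator (g a) + countTrue g N ∎)
  where open ≡-Reasoning

countTrue-partition : ∀ (g h k : ℕ → Bool) →
  (∀ t → indicator (g t) + indicator (h t) + indicator (k t) ≡ 1) →
  ∀ L → countTrue g L + countTrue h L + countTrue k L ≡ L
countTrue-partition g h k one zero    = refl
countTrue-partition g h k one (suc L) = begin
  (G + indicator (g L)) + (H + indicator (h L)) + (K + indicator (k L))
    ≡⟨ cong (_+ (K + indicator (k L))) (ℕ+.interchange G (indicator (g L)) H (indicator (h L))) ⟩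
  (G + H) + (indicator (g L) + indicator (h L)) + (K + indicator (k L))
    ≡⟨ ℕ+.interchange (G + H) _ K (indicator (k L)) ⟩
  (G + H + K) + (indicator (g L) + indicator (h L) + indicator (k L))
    ≡⟨ cong₂ _+_ (countTrue-partition g h k one L) (one L) ⟩
  L + 1
    ≡⟨ ℕ.+-comm L 1 ⟩
  suc L ∎
  where
  open ≡-Reasoning
  G = countTrue g L
  H = countTrue h L
  K = countTrue k L

countTrue-pos : ∀ g L → 1 ≤ countTrue g L → ∃ λ t → t < L × g t ≡ true
countTrue-pos g (suc L) 1≤count with g L in gL
... | true  = L , ℕ.≤-refl , gL
... | false with countTrue-pos g L (subst (1 ≤_) (ℕ.+-identityʳ _) 1≤count)
...   | t , t<L , gt = t , ℕ.m≤n⇒m≤1+n t<L , gt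

rising-edge : ∀ (g : ℕ → Bool) w d → g w ≡ false → g (w + d) ≡ true → ∃ λ u → g u ≡ false × g (suc u) ≡ true
rising-edge g w zero    gw gw+d = ⊥-elim (true≢false (trans (sym gw+d) (trans (cong g (ℕ.+-identityʳ w)) gw)))
rising-edge g w (suc d) gw gw+d with g (suc w) in gw+1
... | true  = w , gw , gw+1
... | false = rising-edge g (suc w) d gw+1 (trans (cong g (sym (ℕ.+-suc w d))) gw+d)

∣∣≡countTrue : ∀ {n} (v : Vec Bool n) (g : ℕ → Bool) → (∀ j → lookup v j ≡ g (toℕ j)) →
  ∣ v ∣ ≡ countTrue g n
∣∣≡countTrue []      g _  = refl
∣∣≡countTrue {suc n} (c ∷ v) g v≡g = begin
  ∣ c ∷ v ∣                                        ≡⟨ ∣∷∣ c ⟩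
  indicator c + ∣ v ∣                              ≡⟨ cong₂ _+_ (cong indicator (v≡g fzero))
                                                        (∣∣≡countTrue v (λ t → g (suc t)) (λ j → v≡g (fsuc j))) ⟩
  indicator (g 0) + countTrue (λ t → g (suc t)) n  ≡⟨ countTrue-suc g n ⟨
  countTrue g (suc n)                              ∎
  where
  open ≡-Reasoning
  ∣∷∣ : ∀ c → ∣ c ∷ v ∣ ≡ indicator c + ∣ v ∣
  ∣∷∣ true  = refl
  ∣∷∣ false = refl

any-tabulate⇒ : ∀ {n} (g : Fin n → Bool) →
  foldr (λ _ → Bool) _∨_ false (tabulate g) ≡ true → ∃ λ i → g i ≡ true
any-tabulate⇒ {suc n} g any with g fzero in eq
... | true  = fzero , eq
... | false with any-tabulate⇒ (λ i → g (fsuc i)) any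
...   | i , gi = fsuc i , gi

any-tabulate⇐ : ∀ {n} (g : Fin n → Bool) i → g i ≡ true →
  foldr (λ _ → Bool) _∨_ false (tabulate g) ≡ true
any-tabulate⇐ g fzero    gi rewrite gi = refl
any-tabulate⇐ g (fsuc i) gi with g fzero
... | true  = refl
... | false = any-tabulate⇐ (λ i → g (fsuc i)) i gi

≡ᵇ-true : ∀ {a b} → a ≡ b → (a ≡ᵇ b) ≡ true
≡ᵇ-true {zero}  refl = refl
≡ᵇ-true {suc a} refl = ≡ᵇ-true {a} refl

≡ᵇ-true⇒≡ : ∀ {a b} → (a ≡ᵇ b) ≡ true → a ≡ b
≡ᵇ-true⇒≡ {zero}  {zero}  _  = refl
≡ᵇ-true⇒≡ {suc a} {suc b} eq = cong suc (≡ᵇ-true⇒≡ eq)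

module _ {n} (x : Vec Bool n) (i : ℕ) where

  private
    Bal : ℕ → Set
    Bal m = onesIn x i m ≡ zerosIn x i m

  searchBal-sound : ∀ fuel m₀ m → searchBal x i fuel m₀ ≡ just m →
    m₀ ≤ m × m < m₀ + fuel × Bal m × (∀ m′ → m₀ ≤ m′ → m′ < m → ¬ Bal m′)
  searchBal-sound (suc fuel) m₀ m found with onesIn x i m₀ ≡ᵇ zerosIn x i m₀ in bal
  searchBal-sound (suc fuel) m₀ m refl | true =
    ℕ.≤-refl , ℕ.m<m+n m₀ (s≤s z≤n) , ≡ᵇ-true⇒≡ bal ,
    λ m′ m₀≤m′ m′<m₀ → ⊥-elim (ℕ.<-irrefl refl (ℕ.<-≤-trans m′<m₀ m₀≤m′))
  searchBal-sound (suc fuel) m₀ m found | false with searchBal-sound fuel (suc m₀) m found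
  ... | m₀<m , m< , bal-m , least =
    ℕ.<⇒≤ m₀<m , subst (m <_) (sym (ℕ.+-suc m₀ fuel)) m< , bal-m , least′
    where
    least′ : ∀ m′ → m₀ ≤ m′ → m′ < m → ¬ Bal m′
    least′ m′ m₀≤m′ m′<m bal′ with ℕ.m≤n⇒m<n∨m≡n m₀≤m′
    ... | inj₁ m₀<m′ = least m′ m₀<m′ m′<m bal′
    ... | inj₂ refl with trans (sym bal) (≡ᵇ-true bal′)
    ...   | ()

  searchBal-complete : ∀ fuel m₀ m → m₀ ≤ m → m < m₀ + fuel → Bal m →
    ∃ λ m′ → searchBal x i fuel m₀ ≡ just m′
  searchBal-complete zero m₀ m m₀≤m m< _ =
    ⊥-elim (ℕ.<-irrefl refl (ℕ.<-≤-trans m< (subst (_≤ m) (sym (ℕ.+-identityʳ m₀)) m₀≤m)))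
  searchBal-complete (suc fuel) m₀ m m₀≤m m< bal-m with onesIn x i m₀ ≡ᵇ zerosIn x i m₀ in bal
  ... | true  = m₀ , refl
  ... | false with ℕ.m≤n⇒m<n∨m≡n m₀≤m
  ...   | inj₁ m₀<m = searchBal-complete fuel (suc m₀) m m₀<m (subst (m <_) (ℕ.+-suc m₀ fuel) m<) bal-m
  ...   | inj₂ refl with trans (sym bal) (≡ᵇ-true bal-m)
  ...     | ()

onesIn+zerosIn : ∀ {n} (x : Vec Bool n) i m → onesIn x i m + zerosIn x i m ≡ suc m
onesIn+zerosIn x i zero with bitAt x i
... | true  = refl
... | false = refl
onesIn+zerosIn x i (suc m) = begin
  (onesIn x i m + indicator c) + (zerosIn x i m + zc)  ≡⟨ ℕ+.interchange (onesIn x i m) (indicator c) _ _ ⟩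
  (onesIn x i m + zerosIn x i m) + (indicator c + zc)  ≡⟨ cong₂ _+_ (onesIn+zerosIn x i m) (complement c) ⟩
  suc m + 1                                            ≡⟨ ℕ.+-comm (suc m) 1 ⟩
  suc (suc m)                                          ∎
  where
  open ≡-Reasoning
  c = bitAt x (i + suc m)
  zc = if c then 0 else 1
  complement : ∀ c → indicator c + (if c then 0 else 1) ≡ 1
  complement true  = refl
  complement false = refl

onesIn-from-0 : ∀ {n} (x : Vec Bool n) m → onesIn x 0 m ≡ countTrue (bitAt x) (suc m)
onesIn-from-0 x zero    = refl
onesIn-from-0 x (suc m) = cong (_+ indicator (bitAt x (suc m))) (onesIn-from-0 x m)

congruent⇒+* : ∀ {a c} N .{{_ : ℕ.NonZero N}} → a % N ≡ c % N → a ≤ c → ∃ λ q → c ≡ a + q * N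
congruent⇒+* {a} {c} N a≡c a≤c = c / N ∸ a / N , (begin
  c                                              ≡⟨ m≡m%n+[m/n]*n c N ⟩
  c % N + c / N * N                              ≡⟨ cong (λ q → c % N + q * N) (ℕ.m+[n∸m]≡n (/-mono-≤ a≤c (ℕ.≤-refl {N}))) ⟨
  c % N + (a / N + (c / N ∸ a / N)) * N          ≡⟨ cong (c % N +_) (ℕ.*-distribʳ-+ N (a / N) _) ⟩
  c % N + (a / N * N + (c / N ∸ a / N) * N)      ≡⟨ ℕ.+-assoc (c % N) _ _ ⟨
  c % N + a / N * N + (c / N ∸ a / N) * N        ≡⟨ cong (λ r → r + a / N * N + (c / N ∸ a / N) * N) a≡c ⟨
  a % N + a / N * N + (c / N ∸ a / N) * N        ≡⟨ cong (_+ (c / N ∸ a / N) * N) (m≡m%n+[m/n]*n a N) ⟨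
  a + (c / N ∸ a / N) * N                        ∎)
  where open ≡-Reasoning

-- The walk of a cyclic string and the matching

module Cyclic {n} (x : Subset (suc n)) where

  N : ℕ
  N = suc n

  b : ℕ → Bool
  b = bitAt x

  S : ℕ → ℤ
  S = height b

  open Walk b public

  mod-cong : ∀ t u → t % N ≡ u % N → t mod N ≡ u mod N
  mod-cong t u t≡u = fromℕ<-cong (t % N) (u % N) t≡u _ _

  toℕ-mod : ∀ t → toℕ (t mod N) ≡ t % N
  toℕ-mod t = toℕ-fromℕ< _

  toℕ-mod-id : ∀ (j : Fin N) → toℕ j mod N ≡ j
  toℕ-mod-id j = trans (fromℕ<-cong (toℕ j % N) (toℕ j) (m<n⇒m%n≡m (toℕ<n j)) _ (toℕ<n j)) (fromℕ<-toℕ j (toℕ<n j))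

  bitAt-toℕ : ∀ j → b (toℕ j) ≡ lookup x j
  bitAt-toℕ j = cong (lookup x) (toℕ-mod-id j)

  bitAt-+* : ∀ t q → b (t + q * N) ≡ b t
  bitAt-+* t q = cong (lookup x) (mod-cong (t + q * N) t ([m+kn]%n≡m%n t q N))

  mod-+N : ∀ t → (t + N) mod N ≡ t mod N
  mod-+N t = mod-cong (t + N) t ([m+n]%n≡m%n t N)

  bitAt-+N : ∀ t → b (t + N) ≡ b t
  bitAt-+N t = cong (lookup x) (mod-+N t)

  height-+* : ∀ t q → S (t + q * N) ≡ S t ℤ.+ S (q * N)
  height-+* zero    q = sym (ℤ.+-identityˡ _)
  height-+* (suc t) q = begin
    step (b (t + q * N)) (S (t + q * N))  ≡⟨ cong₂ step (bitAt-+* t q) (height-+* t q) ⟩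
    step (b t) (S t ℤ.+ S (q * N))        ≡⟨ step-+ (b t) (S t) (S (q * N)) ⟩
    S (suc t) ℤ.+ S (q * N)               ∎
    where open ≡-Reasoning

  height-+N : ∀ t → S (t + N) ≡ S t ℤ.+ S N
  height-+N t = subst (λ m → S (t + m) ≡ S t ℤ.+ S m) (ℕ.*-identityˡ N) (height-+* t 1)

  height-window : ∀ i m → S (i + suc m) ℤ.+ pos (zerosIn x i m) ≡ S i ℤ.+ pos (onesIn x i m)
  height-window i zero = begin
    S (i + 1) ℤ.+ pos (zerosIn x i 0)  ≡⟨ cong (λ t → S t ℤ.+ pos (zerosIn x i 0)) (ℕ.+-comm i 1) ⟩
    step (b i) (S i) ℤ.+ pos (zerosIn x i 0)  ≡⟨ step-count (b i) (S i) ⟩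
    S i ℤ.+ pos (onesIn x i 0)         ∎
    where open ≡-Reasoning
  height-window i (suc m) = begin
    S (i + suc (suc m)) ℤ.+ pos (z + zc)   ≡⟨ cong₂ ℤ._+_ (cong S (ℕ.+-suc i (suc m))) (ℤ.pos-+ z zc) ⟩
    step c A ℤ.+ (pos z ℤ.+ pos zc)        ≡⟨ ℤ+.x∙yz≈xz∙y (step c A) (pos z) (pos zc) ⟩
    (step c A ℤ.+ pos zc) ℤ.+ pos z        ≡⟨ cong (ℤ._+ pos z) (step-count c A) ⟩
    (A ℤ.+ pos oc) ℤ.+ pos z               ≡⟨ ℤ+.xy∙z≈xz∙y A (pos oc) (pos z) ⟩
    (A ℤ.+ pos z) ℤ.+ pos oc               ≡⟨ cong (ℤ._+ pos oc) (height-window i m) ⟩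
    (S i ℤ.+ pos o) ℤ.+ pos oc             ≡⟨ ℤ.+-assoc (S i) (pos o) (pos oc) ⟩
    S i ℤ.+ (pos o ℤ.+ pos oc)             ≡⟨ cong (λ w → S i ℤ.+ w) (ℤ.pos-+ o oc) ⟨
    S i ℤ.+ pos (o + oc)                   ∎
    where
    open ≡-Reasoning
    A = S (i + suc m)
    c = b (i + suc m)
    z = zerosIn x i m
    o = onesIn x i m
    zc = if c then 0 else 1
    oc = if c then 1 else 0

  Balanced : ℕ → ℕ → Set
  Balanced i m = S (i + suc m) ≡ S i

  onesIn≡zerosIn⇒balanced : ∀ i m → onesIn x i m ≡ zerosIn x i m → Balanced i m
  onesIn≡zerosIn⇒balanced i m o≡z =
    ∙-cancelʳ (pos (zerosIn x i m)) _ _ (trans (height-window i m) (cong (λ k → S i ℤ.+ pos k) o≡z))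

  balanced⇒onesIn≡zerosIn : ∀ i m → Balanced i m → onesIn x i m ≡ zerosIn x i m
  balanced⇒onesIn≡zerosIn i m bal =
    sym (ℤ.+-injective (∙-cancelˡ (S i) _ _ (trans (cong (ℤ._+ pos (zerosIn x i m)) (sym bal)) (height-window i m))))

  window-+* : ∀ i q m → S (i + q * N + suc m) ≡ S (i + suc m) ℤ.+ S (q * N)
  window-+* i q m = trans (cong S (ℕ+.xy∙z≈xz∙y i (q * N) (suc m))) (height-+* (i + suc m) q)

  balanced-+*⇒ : ∀ i q m → Balanced (i + q * N) m → Balanced i m
  balanced-+*⇒ i q m bal =
    ∙-cancelʳ (S (q * N)) _ _ (trans (sym (window-+* i q m)) (trans bal (height-+* i q)))

  balanced-+*⇐ : ∀ i q m → Balanced i m → Balanced (i + q * N) m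
  balanced-+*⇐ i q m bal =
    trans (window-+* i q m) (trans (cong (ℤ._+ S (q * N)) bal) (sym (height-+* i q)))

  toℕ-mod-+ : ∀ t m → (toℕ (t mod N) + m) mod N ≡ (t + m) mod N
  toℕ-mod-+ t m = mod-cong (toℕ (t mod N) + m) (t + m) (begin
    (toℕ (t mod N) + m) % N      ≡⟨ cong (λ r → (r + m) % N) (toℕ-mod t) ⟩
    (t % N + m) % N              ≡⟨ [m+kn]%n≡m%n (t % N + m) (t / N) N ⟨
    (t % N + m + t / N * N) % N  ≡⟨ cong (_% N) (ℕ+.xy∙z≈xz∙y (t % N) m (t / N * N)) ⟩
    (t % N + t / N * N + m) % N  ≡⟨ cong (λ r → (r + m) % N) (m≡m%n+[m/n]*n t N) ⟨
    (t + m) % N                  ∎)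
    where open ≡-Reasoning

  matchLen-sound : ∀ j {m} → matchLen x j ≡ just m →
    m < N × Balanced (toℕ j) m × (∀ m′ → m′ < m → ¬ Balanced (toℕ j) m′)
  matchLen-sound j found with searchBal-sound x (toℕ j) N 0 _ found
  ... | _ , m<N , bal , least =
    m<N , onesIn≡zerosIn⇒balanced (toℕ j) _ bal ,
    λ m′ m′<m bal′ → least m′ z≤n m′<m (balanced⇒onesIn≡zerosIn (toℕ j) m′ bal′)

  matchLen-least : ∀ j {m} → m < N → Balanced (toℕ j) m →
    (∀ m′ → m′ < m → ¬ Balanced (toℕ j) m′) → matchLen x j ≡ just m
  matchLen-least j {m} m<N bal least
    with searchBal-complete x (toℕ j) N 0 m z≤n m<N (balanced⇒onesIn≡zerosIn (toℕ j) m bal)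
  ... | m″ , found with matchLen-sound j found
  ...   | _ , bal″ , least″ with ℕ.<-cmp m″ m
  ...     | tri< m″<m _ _ = ⊥-elim (least m″ m″<m bal″)
  ...     | tri≈ _ refl _ = found
  ...     | tri> _ _ m<m″ = ⊥-elim (least″ m m<m″ bal)

  matchLen-mod : ∀ t m → m < N → Balanced t m → (∀ m′ → m′ < m → ¬ Balanced t m′) →
    matchLen x (t mod N) ≡ just m
  matchLen-mod t m m<N bal least =
    matchLen-least (t mod N) m<N (unshift bal) (λ m′ m′<m bal′ → least m′ m′<m (shift bal′))
    where
    t≡ : t ≡ toℕ (t mod N) + t / N * N
    t≡ = trans (m≡m%n+[m/n]*n t N) (cong (_+ t / N * N) (sym (toℕ-mod t)))
    unshift : ∀ {m′} → Balanced t m′ → Balanced (toℕ (t mod N)) m′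
    unshift {m′} bal = balanced-+*⇒ (toℕ (t mod N)) (t / N) m′ (subst (λ s → Balanced s m′) t≡ bal)
    shift : ∀ {m′} → Balanced (toℕ (t mod N)) m′ → Balanced t m′
    shift {m′} bal = subst (λ s → Balanced s m′) (sym t≡) (balanced-+*⇐ (toℕ (t mod N)) (t / N) m′ bal)

  matchedTo⇒ : ∀ i j → matchedTo x i j ≡ true →
    lookup x i ≡ true × ∃ λ m → matchLen x i ≡ just m × (toℕ i + m) mod N ≡ j
  matchedTo⇒ i j i↦j with lookup x i | matchLen x i
  ... | true | just m with (toℕ i + m) mod N ≟ᶠ j
  ...   | yes i+m≡j = refl , m , refl , i+m≡j
  matchedTo⇒ i j () | true  | just m | no _
  matchedTo⇒ i j () | true  | nothing
  matchedTo⇒ i j () | false | _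

  matchedTo⇐ : ∀ i j m → lookup x i ≡ true → matchLen x i ≡ just m → (toℕ i + m) mod N ≡ j →
    matchedTo x i j ≡ true
  matchedTo⇐ i j m one found i+m≡j with lookup x i | matchLen x i
  matchedTo⇐ i j m refl refl i+m≡j | true | just .m with (toℕ i + m) mod N ≟ᶠ j
  ... | yes _    = refl
  ... | no i+m≢j = ⊥-elim (i+m≢j i+m≡j)

  Covered : ℕ → Set
  Covered J = ∃ λ s → s ≤ J × J < s + N × S s ℤ.≤ S (suc J)

  -- The bound on J guarantees I + m ≤ J, so that J = I + m + q * N for some q.
  balanced⇒covered : ∀ I m J → I < N → m < N → n + n ≤ J → (I + m) % N ≡ J % N →
    Balanced I m → Covered J
  balanced⇒covered I m J I<N m<N 2n≤J I+m≡J bal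
    with congruent⇒+* N I+m≡J (ℕ.≤-trans (ℕ.+-mono-≤ (ℕ.s≤s⁻¹ I<N) (ℕ.s≤s⁻¹ m<N)) 2n≤J)
  ... | q , refl = I + q * N , s≤J , J<s+N , ℤ.≤-reflexive (trans (sym (balanced-+*⇐ I q m bal)) (cong S s+1+m≡))
    where
    s+m≡ : I + q * N + m ≡ I + m + q * N
    s+m≡ = ℕ+.xy∙z≈xz∙y I (q * N) m
    s≤J : I + q * N ≤ I + m + q * N
    s≤J = ℕ.+-monoˡ-≤ (q * N) (ℕ.m≤m+n I m)
    J<s+N : I + m + q * N < I + q * N + N
    J<s+N = subst (_< I + q * N + N) s+m≡ (ℕ.+-monoʳ-< (I + q * N) m<N)
    s+1+m≡ : I + q * N + suc m ≡ suc (I + m + q * N)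
    s+1+m≡ = trans (ℕ.+-suc (I + q * N) m) (cong suc s+m≡)

  matched0⇒covered : ∀ J → n + n ≤ J → matched0 x (J mod N) ≡ true → Covered J
  matched0⇒covered J 2n≤J matched with any-tabulate⇒ (λ i → matchedTo x i (J mod N)) matched
  ... | i , i↦J with matchedTo⇒ i (J mod N) i↦J
  ...   | _ , m , found , i+m↦J with matchLen-sound i found
  ...     | m<N , bal , _ = balanced⇒covered (toℕ i) m J (toℕ<n i) m<N 2n≤J
              (trans (sym (toℕ-mod (toℕ i + m))) (trans (cong toℕ i+m↦J) (toℕ-mod J))) bal

  covered⇒matched0 : ∀ J → b J ≡ false → Covered J → matched0 x (J mod N) ≡ true
  covered⇒matched0 J bJ (s , s≤J , J<s+N , Ss≤) with last-ascent s (J ∸ s) (S (suc J)) Ss≤ SJ+1<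
    where
    SJ+1< : S (suc J) ℤ.< S (s + (J ∸ s))
    SJ+1< = subst (λ t → S (suc J) ℤ.< S t) (sym (ℕ.m+[n∸m]≡n s≤J))
              (subst (ℤ._< S J) (cong (λ c → step c (S J)) (sym bJ)) (pred[i]<i (S J)))
  ... | s′ , s≤s′ , s′< , Ss′≡ , above =
    any-tabulate⇐ (λ i → matchedTo x i (J mod N)) (s′ mod N) (matchedTo⇐ (s′ mod N) (J mod N) m bs′
      (matchLen-mod s′ m m<N bal least) (trans (toℕ-mod-+ s′ m) (cong (λ r → r mod N) s′+m≡J)))
    where
    J≡ : s + (J ∸ s) ≡ J
    J≡ = ℕ.m+[n∸m]≡n s≤J
    s′<J : s′ < J
    s′<J = subst (s′ <_) J≡ s′<
    m = J ∸ s′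
    s′+m≡J : s′ + m ≡ J
    s′+m≡J = ℕ.m+[n∸m]≡n (ℕ.<⇒≤ s′<J)
    bs′ : lookup x (s′ mod N) ≡ true
    bs′ = proj₁ (step-crosses-up (b s′) (ℤ.≤-reflexive Ss′≡)
            (above (suc s′) ℕ.≤-refl (subst (suc s′ ≤_) (sym J≡) s′<J)))
    m<N : m < N
    m<N = ℕ.m<n+o⇒m∸n<o J s′ (ℕ.<-≤-trans J<s+N (ℕ.+-monoˡ-≤ N s≤s′))
    bal : Balanced s′ m
    bal = trans (cong S (trans (ℕ.+-suc s′ m) (cong suc s′+m≡J))) (sym Ss′≡)
    least : ∀ m′ → m′ < m → ¬ Balanced s′ m′
    least m′ m′<m bal′ = ℤ.<-irrefl (trans (sym Ss′≡) (sym bal′))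
      (above (s′ + suc m′) (ℕ.m<m+n s′ (s≤s z≤n))
        (subst (s′ + suc m′ ≤_) (trans s′+m≡J (sym J≡)) (subst (_≤ s′ + m) (sym (ℕ.+-suc s′ m′)) (ℕ.+-monoʳ-< s′ m′<m))))

  rise-fall⇒covered : 2 ≤ N → ∀ u → b u ≡ true → b (suc u) ≡ false → Covered (suc u)
  rise-fall⇒covered 2≤N u bu bu+1 =
    u , ℕ.n≤1+n u , subst (_≤ u + N) (ℕ.+-comm u 2) (ℕ.+-monoʳ-≤ u 2≤N) , ℤ.≤-reflexive (sym S-returns)
    where
    S-returns : S (suc (suc u)) ≡ S u
    S-returns = trans (cong₂ (λ c c′ → step c′ (step c (S u))) bu bu+1) (ℤ.pred-suc (S u))

module _ {n} (x : Subset (suc n)) where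

  open Cyclic x

  ∣∣≡countTrue-bitAt : ∣ x ∣ ≡ countTrue b N
  ∣∣≡countTrue-bitAt = ∣∣≡countTrue x b (λ j → sym (bitAt-toℕ j))

  zeroCount : ℕ
  zeroCount = zerosIn x 0 n

  private
    ones≡∣∣ : onesIn x 0 n ≡ ∣ x ∣
    ones≡∣∣ = trans (onesIn-from-0 x n) (sym ∣∣≡countTrue-bitAt)

  ∣∣+zeros≡N : ∣ x ∣ + zeroCount ≡ N
  ∣∣+zeros≡N = trans (cong (_+ zeroCount) (sym ones≡∣∣)) (onesIn+zerosIn x 0 n)

  drift+zeros≡∣∣ : S N ℤ.+ pos zeroCount ≡ pos ∣ x ∣
  drift+zeros≡∣∣ = trans (height-window 0 n) (trans (ℤ.+-identityˡ _) (cong pos ones≡∣∣))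

  ∣∣<zeros : ∣ x ∣ + ∣ x ∣ < N → ∣ x ∣ < zeroCount
  ∣∣<zeros 2∣x∣<N = ℕ.+-cancelˡ-< ∣ x ∣ ∣ x ∣ zeroCount (subst (∣ x ∣ + ∣ x ∣ <_) (sym ∣∣+zeros≡N) 2∣x∣<N)

  drift-negative : ∣ x ∣ + ∣ x ∣ < N → S N ℤ.< 0ℤ
  drift-negative 2∣x∣<N = ℤ.≰⇒> λ 0≤SN →
    ℕ.<⇒≱ (∣∣<zeros 2∣x∣<N) (ℤ.drop‿+≤+ (subst (pos zeroCount ℤ.≤_) drift+zeros≡∣∣ (ℤ.+-monoˡ-≤ (pos zeroCount) 0≤SN)))

module NegativeDrift {n} (x : Subset (suc n)) (drift : Cyclic.S x (suc n) ℤ.< 0ℤ) where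

  open Cyclic x

  first-return : ∀ t → b t ≡ true →
    ∃ λ e → suc t < e × e ≤ t + N × S e ≡ S t × (∀ s → suc t ≤ s → s < e → S t ℤ.< S s)
  first-return t bt with first-descent (suc t) n (S t) St<St+1 St+N≤St
    where
    St<St+1 : S t ℤ.< S (suc t)
    St<St+1 = subst (λ c → S t ℤ.< step c (S t)) (sym bt) (i<suc[i] (S t))
    St+N≤St : S (suc t + n) ℤ.≤ S t
    St+N≤St = subst (ℤ._≤ S t) (trans (sym (height-+N t)) (cong S (ℕ.+-suc t n)))
                (subst (S t ℤ.+ S N ℤ.≤_) (ℤ.+-identityʳ (S t)) (ℤ.+-monoʳ-≤ (S t) (ℤ.<⇒≤ drift)))
  ... | e , 1+t<e , e≤ , Se≡St , above = e , 1+t<e , subst (e ≤_) (sym (ℕ.+-suc t n)) e≤ , Se≡St , above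

  one⇒matchLen : ∀ t → b t ≡ true → ∃ λ m → matchLen x (t mod N) ≡ just m
  one⇒matchLen t bt with first-return t bt
  ... | e , 1+t<e , e≤t+N , Se≡St , above = m , matchLen-mod t m m<N bal least
    where
    m = e ∸ suc t
    t+1+m≡e : t + suc m ≡ e
    t+1+m≡e = trans (ℕ.+-suc t m) (ℕ.m+[n∸m]≡n (ℕ.<⇒≤ 1+t<e))
    m<N : m < N
    m<N = ℕ.m<n+o⇒m∸n<o e (suc t) (s≤s e≤t+N)
    bal : Balanced t m
    bal = trans (cong S t+1+m≡e) Se≡St
    least : ∀ m′ → m′ < m → ¬ Balanced t m′
    least m′ m′<m bal′ = ℤ.<-irrefl (sym bal′) (above (t + suc m′)
      (subst (suc t ≤_) (sym (ℕ.+-suc t m′)) (s≤s (ℕ.m≤m+n t m′)))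
      (subst (t + suc m′ <_) t+1+m≡e (ℕ.+-monoʳ-< t (s≤s m′<m))))

  lookup-f : ∀ j → lookup (f x) j ≡ (if lookup x j then false else matched0 x j)
  lookup-f j = trans (lookup∘tabulate fbit j) (every-one-matched (lookup x j) refl)
    where
    fbit : Fin N → Bool
    fbit j = if lookup x j then (if is-just (matchLen x j) then false else true) else matched0 x j
    every-one-matched : ∀ c → lookup x j ≡ c →
      (if c then (if is-just (matchLen x j) then false else true) else matched0 x j)
        ≡ (if c then false else matched0 x j)
    every-one-matched false _   = refl
    every-one-matched true  one =
      cong (λ r → if is-just r then false else true) (subst (λ i → matchLen x i ≡ just (proj₁ matched))
        (toℕ-mod-id j) (proj₂ matched))
      where matched = one⇒matchLen (toℕ j) (trans (bitAt-toℕ j) one)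

  bitAt-f : ∀ t → bitAt (f x) t ≡ (if b t then false else matched0 x (t mod N))
  bitAt-f t = lookup-f (t mod N)

-- Unmatched zeros and the weight of f x

module UnmatchedZeros {n} (x : Subset (suc n)) (drift : Cyclic.S x (suc n) ℤ.< 0ℤ) where

  open Cyclic x
  open NegativeDrift x drift
  open RangeMin S

  unmatched0 : ℕ → Bool
  unmatched0 t = not (b t) ∧ not (matched0 x (t mod N))

  unmatched0-+N : ∀ t → unmatched0 (t + N) ≡ unmatched0 t
  unmatched0-+N t = cong₂ (λ c j → not c ∧ not (matched0 x j)) (bitAt-+N t) (mod-+N t)

  f-complement : ∀ t → unmatched0 t ≡ false → bitAt (f x) t ≡ not (b t)
  f-complement t not-unmatched = trans (bitAt-f t) (cases (b t) (matched0 x (t mod N)) not-unmatched)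
    where
    cases : ∀ c m → not c ∧ not m ≡ false → (if c then false else m) ≡ not c
    cases true  m    _ = refl
    cases false true _ = refl

  unmatched-zero : ∀ t → unmatched0 t ≡ true → b t ≡ false × matched0 x (t mod N) ≡ false
  unmatched-zero t unmatched = cases (b t) (matched0 x (t mod N)) unmatched
    where
    cases : ∀ c m → not c ∧ not m ≡ true → c ≡ false × m ≡ false
    cases false false _ = refl , refl

  f-one : ∀ t → b t ≡ true → bitAt (f x) t ≡ false
  f-one t bt = trans (bitAt-f t) (cong (λ c → if c then false else matched0 x (t mod N)) bt)

  f-unmatched : ∀ t → unmatched0 t ≡ true → bitAt (f x) t ≡ false
  f-unmatched t unmatched = trans (bitAt-f t)
    (trans (cong (λ c → if c then false else matched0 x (t mod N)) (proj₁ (unmatched-zero t unmatched)))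
           (proj₂ (unmatched-zero t unmatched)))

  unmatched⇒uncovered : ∀ t → unmatched0 t ≡ true → ¬ Covered t
  unmatched⇒uncovered t unmatched covered = true≢false (trans
    (sym (covered⇒matched0 t (proj₁ (unmatched-zero t unmatched)) covered)) (proj₂ (unmatched-zero t unmatched)))

  not-unmatched-zero : ∀ t → b t ≡ false → unmatched0 t ≡ false → matched0 x (t mod N) ≡ true
  not-unmatched-zero t bt not-unmatched = cases (matched0 x (t mod N))
    (trans (cong (λ c → not c ∧ not (matched0 x (t mod N))) (sym bt)) not-unmatched)
    where
    cases : ∀ m → not false ∧ not m ≡ false → m ≡ true
    cases true _ = refl

  W : ℕ → ℤ
  W a = rangeMin a n

  W-+N : ∀ a → W (a + N) ≡ W a ℤ.+ S N
  W-+N a = sym (rangeMin-unique (a + N) n (W a ℤ.+ S N) lower attained)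
    where
    shift : ∀ l → S (a + N + l) ≡ S (a + l) ℤ.+ S N
    shift l = trans (cong S (ℕ+.xy∙z≈xz∙y a N l)) (height-+N (a + l))
    lower : ∀ l → l ≤ n → W a ℤ.+ S N ℤ.≤ S (a + N + l)
    lower l l≤n = subst (W a ℤ.+ S N ℤ.≤_) (sym (shift l)) (ℤ.+-monoˡ-≤ (S N) (rangeMin-≤ a n l l≤n))
    attained : ∃ λ l → l ≤ n × W a ℤ.+ S N ≡ S (a + N + l)
    attained with rangeMin-attained a n
    ... | l , l≤n , W≡ = l , l≤n , trans (cong (ℤ._+ S N) W≡) (sym (shift l))

  private
    S[a+N]<S[a] : ∀ a → S (a + N) ℤ.< S a
    S[a+N]<S[a] a = subst₂ ℤ._<_ (sym (height-+N a)) (ℤ.+-identityʳ (S a)) (ℤ.+-monoʳ-< (S a) drift)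

  W-step-covered : ∀ a → W a ℤ.≤ S (a + N) → unmatched0 (a + n) ≡ false × W (suc a) ≡ W a
  W-step-covered a W≤ with rangeMin-attained a n
  ... | l₀ , l₀≤n , W≡ = ¬-not (λ unmatched → unmatched⇒uncovered z unmatched covered) , sym (rangeMin-unique (suc a) n (W a) lower attained)
    where
    z = a + n
    Sz+1≡ : S (suc z) ≡ S (a + N)
    Sz+1≡ = cong S (sym (ℕ.+-suc a n))
    covered : Covered z
    covered = a + l₀ , ℕ.+-monoʳ-≤ a l₀≤n ,
              ℕ.<-≤-trans (ℕ.+-monoʳ-< a (ℕ.n<1+n n)) (ℕ.+-monoˡ-≤ N (ℕ.m≤m+n a l₀)) ,
              subst₂ ℤ._≤_ W≡ (sym Sz+1≡) W≤
    lower : ∀ l → l ≤ n → W a ℤ.≤ S (suc a + l)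
    lower l l≤n with ℕ.m≤n⇒m<n∨m≡n l≤n
    ... | inj₂ refl = subst (W a ℤ.≤_) (sym Sz+1≡) W≤
    ... | inj₁ l<n  = subst (λ t → W a ℤ.≤ S t) (ℕ.+-suc a l) (rangeMin-≤ a n (suc l) l<n)
    attained′ : ∀ l → l ≤ n → W a ≡ S (a + l) → ∃ λ l → l ≤ n × W a ≡ S (suc a + l)
    attained′ zero    _     W≡Sa = ⊥-elim (ℤ.<-irrefl refl
      (ℤ.<-≤-trans (S[a+N]<S[a] a) (subst (ℤ._≤ S (a + N)) (trans W≡Sa (cong S (ℕ.+-identityʳ a))) W≤)))
    attained′ (suc l) 1+l≤n W≡Sl = l , ℕ.≤-trans (ℕ.n≤1+n l) 1+l≤n , trans W≡Sl (cong S (ℕ.+-suc a l))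
    attained : ∃ λ l → l ≤ n × W a ≡ S (suc a + l)
    attained = attained′ l₀ l₀≤n W≡

  W-step-uncovered : ∀ a → n ≤ a → S (a + N) ℤ.< W a → unmatched0 (a + n) ≡ true × sucℤ (W (suc a)) ≡ W a
  W-step-uncovered a n≤a S<W = cong₂ (λ c m → not c ∧ not m) bz≡false unmatched , W′≡
    where
    z = a + n
    Sz+1≡ : S (suc z) ≡ S (a + N)
    Sz+1≡ = cong S (sym (ℕ.+-suc a n))
    Sz+1<W : S (suc z) ℤ.< W a
    Sz+1<W = subst (ℤ._< W a) (sym Sz+1≡) S<W
    W≤Sz : W a ℤ.≤ S z
    W≤Sz = rangeMin-≤ a n n ℕ.≤-refl
    bz≡false : b z ≡ false
    bz≡false = ¬-not λ bz → ℤ.<-irrefl refl (ℤ.<-trans Sz+1<W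
      (ℤ.≤-<-trans W≤Sz (subst (S z ℤ.<_) (cong (λ c → step c (S z)) (sym bz)) (i<suc[i] (S z)))))
    uncovered : ¬ Covered z
    uncovered (s , s≤z , z<s+N , Ss≤) = ℤ.<-irrefl refl
      (ℤ.<-≤-trans Sz+1<W (ℤ.≤-trans (subst (W a ℤ.≤_) (cong S (ℕ.m+[n∸m]≡n a≤s)) (rangeMin-≤ a n (s ∸ a) s∸a≤n)) Ss≤))
      where
      a≤s : a ≤ s
      a≤s = ℕ.+-cancelʳ-≤ N a s (subst (_≤ s + N) (sym (ℕ.+-suc a n)) z<s+N)
      s∸a≤n : s ∸ a ≤ n
      s∸a≤n = subst (s ∸ a ≤_) (ℕ.m+n∸m≡n a n) (ℕ.∸-monoˡ-≤ a s≤z)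
    unmatched : matched0 x (z mod N) ≡ false
    unmatched = ¬-not λ matched → uncovered (matched0⇒covered z (ℕ.+-monoˡ-≤ n n≤a) matched)
    lower : ∀ l → l ≤ n → S (suc z) ℤ.≤ S (suc a + l)
    lower l l≤n with ℕ.m≤n⇒m<n∨m≡n l≤n
    ... | inj₂ refl = ℤ.≤-refl
    ... | inj₁ l<n  = ℤ.<⇒≤ (ℤ.<-≤-trans Sz+1<W
                        (subst (λ t → W a ℤ.≤ S t) (ℕ.+-suc a l) (rangeMin-≤ a n (suc l) l<n)))
    Sz≡ : S z ≡ sucℤ (S (suc z))
    Sz≡ = sym (trans (cong (λ c → sucℤ (step c (S z))) bz≡false) (ℤ.suc-pred (S z)))
    W′≡ : sucℤ (W (suc a)) ≡ W a
    W′≡ = trans (cong sucℤ (sym (rangeMin-unique (suc a) n (S (suc z)) lower (n , ℕ.≤-refl , refl))))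
                (ℤ.≤-antisym (ℤ.i<j⇒suc[i]≤j Sz+1<W) (subst (W a ℤ.≤_) Sz≡ W≤Sz))

  W-step : ∀ a → n ≤ a → W (suc a) ℤ.+ pos (indicator (unmatched0 (a + n))) ≡ W a
  W-step a n≤a with W a ℤ.≤? S (a + N)
  ... | yes W≤ = trans (cong₂ (λ w u → w ℤ.+ pos (indicator u)) W′≡W unmatched≡false) (ℤ.+-identityʳ (W a))
    where
    unmatched≡false = proj₁ (W-step-covered a W≤)
    W′≡W = proj₂ (W-step-covered a W≤)
  ... | no W≰ = trans (cong (λ u → W (suc a) ℤ.+ pos (indicator u)) unmatched≡true)
                      (trans (ℤ.+-comm (W (suc a)) (pos 1)) sucW′≡W)
    where
    unmatched≡true = proj₁ (W-step-uncovered a n≤a (ℤ.≰⇒> W≰))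
    sucW′≡W = proj₂ (W-step-uncovered a n≤a (ℤ.≰⇒> W≰))

  unmatched-telescope : ∀ a L → n ≤ a →
    pos (countTrue (λ t → unmatched0 (a + n + t)) L) ℤ.+ W (a + L) ≡ W a
  unmatched-telescope a zero    n≤a = trans (ℤ.+-identityˡ _) (cong W (ℕ.+-identityʳ a))
  unmatched-telescope a (suc L) n≤a = begin
    pos (C + indicator (unmatched0 (a + n + L))) ℤ.+ W (a + suc L)
      ≡⟨ cong₂ ℤ._+_ (ℤ.pos-+ C (indicator (unmatched0 (a + n + L)))) (cong W (ℕ.+-suc a L)) ⟩
    (pos C ℤ.+ pos (indicator (unmatched0 (a + n + L)))) ℤ.+ W (suc (a + L))
      ≡⟨ ℤ+.xy∙z≈x∙zy (pos C) (pos (indicator (unmatched0 (a + n + L)))) (W (suc (a + L))) ⟩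
    pos C ℤ.+ (W (suc (a + L)) ℤ.+ pos (indicator (unmatched0 (a + n + L))))
      ≡⟨ cong (λ t → pos C ℤ.+ (W (suc (a + L)) ℤ.+ pos (indicator (unmatched0 t)))) (ℕ+.xy∙z≈xz∙y a n L) ⟩
    pos C ℤ.+ (W (suc (a + L)) ℤ.+ pos (indicator (unmatched0 (a + L + n))))
      ≡⟨ cong (λ w → pos C ℤ.+ w) (W-step (a + L) (ℕ.≤-trans n≤a (ℕ.m≤m+n a L))) ⟩
    pos C ℤ.+ W (a + L)
      ≡⟨ unmatched-telescope a L n≤a ⟩
    W a ∎
    where
    open ≡-Reasoning
    C = countTrue (λ t → unmatched0 (a + n + t)) L

  unmatchedCount : ℕ
  unmatchedCount = countTrue unmatched0 N

  unmatchedCount+drift≡0 : pos unmatchedCount ℤ.+ S N ≡ 0ℤ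
  unmatchedCount+drift≡0 = ∙-cancelʳ (W n) _ _ (begin
    (pos U ℤ.+ S N) ℤ.+ W n   ≡⟨ ℤ+.xy∙z≈x∙zy (pos U) (S N) (W n) ⟩
    pos U ℤ.+ (W n ℤ.+ S N)   ≡⟨ cong (λ w → pos U ℤ.+ w) (W-+N n) ⟨
    pos U ℤ.+ W (n + N)       ≡⟨ cong (λ c → pos c ℤ.+ W (n + N)) (countTrue-shift unmatched0 N unmatched0-+N (n + n)) ⟨
    pos (countTrue (λ t → unmatched0 (n + n + t)) N) ℤ.+ W (n + N)
                              ≡⟨ unmatched-telescope n N ℕ.≤-refl ⟩
    W n                       ≡⟨ ℤ.+-identityˡ (W n) ⟨
    0ℤ ℤ.+ W n                ∎)
    where
    open ≡-Reasoning
    U = unmatchedCount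

  unmatchedCount+∣∣≡zeros : unmatchedCount + ∣ x ∣ ≡ zeroCount x
  unmatchedCount+∣∣≡zeros = ℤ.+-injective (begin
    pos (U + ∣ x ∣)                          ≡⟨ ℤ.pos-+ U (∣ x ∣) ⟩
    pos U ℤ.+ pos ∣ x ∣                      ≡⟨ cong (λ w → pos U ℤ.+ w) (drift+zeros≡∣∣ x) ⟨
    pos U ℤ.+ (S N ℤ.+ pos (zeroCount x))    ≡⟨ ℤ.+-assoc (pos U) (S N) _ ⟨
    (pos U ℤ.+ S N) ℤ.+ pos (zeroCount x)    ≡⟨ cong (ℤ._+ pos (zeroCount x)) unmatchedCount+drift≡0 ⟩
    0ℤ ℤ.+ pos (zeroCount x)                 ≡⟨ ℤ.+-identityˡ _ ⟩
    pos (zeroCount x)                        ∎)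
    where
    open ≡-Reasoning
    U = unmatchedCount

  one-of-three : ∀ t → indicator (b t) + indicator (bitAt (f x) t) + indicator (unmatched0 t) ≡ 1
  one-of-three t = trans (cong (λ y → indicator (b t) + indicator y + indicator (unmatched0 t)) (bitAt-f t))
                         (cases (b t) (matched0 x (t mod N)))
    where
    cases : ∀ c m → indicator c + indicator (if c then false else m) + indicator (not c ∧ not m) ≡ 1
    cases true  m     = refl
    cases false true  = refl
    cases false false = refl

  ∣f∣≡∣∣ : ∣ f x ∣ ≡ ∣ x ∣
  ∣f∣≡∣∣ = ℕ.+-cancelˡ-≡ (∣ x ∣ + U) _ _ (begin
    ∣ x ∣ + U + ∣ f x ∣    ≡⟨ ℕ+.xy∙z≈xz∙y (∣ x ∣) U (∣ f x ∣) ⟩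
    ∣ x ∣ + ∣ f x ∣ + U    ≡⟨ cong₂ (λ p q → p + q + U) (∣∣≡countTrue-bitAt x) (∣∣≡countTrue-bitAt (f x)) ⟩
    countTrue b N + countTrue (bitAt (f x)) N + countTrue unmatched0 N
                           ≡⟨ countTrue-partition b (bitAt (f x)) unmatched0 one-of-three N ⟩
    N                      ≡⟨ ∣∣+zeros≡N x ⟨
    ∣ x ∣ + zeroCount x    ≡⟨ cong (∣ x ∣ +_) unmatchedCount+∣∣≡zeros ⟨
    ∣ x ∣ + (U + ∣ x ∣)    ≡⟨ ℕ.+-assoc (∣ x ∣) U (∣ x ∣) ⟨
    ∣ x ∣ + U + ∣ x ∣      ∎)
    where
    open ≡-Reasoning
    U = unmatchedCount

-- Injectivity

PreimageOne : ∀ {n} → Subset (suc n) → ℕ → Set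
PreimageOne {n} y J = bitAt y J ≡ false ×
  ∃ λ t → J < t × t ≤ J + suc n × height (bitAt y) J ℤ.≤ height (bitAt y) t

module Injectivity {n} (x : Subset (suc n)) (drift : Cyclic.S x (suc n) ℤ.< 0ℤ) where

  open Cyclic x
  open NegativeDrift x drift
  open UnmatchedZeros x drift
  open RangeMin S

  private
    T : ℕ → ℤ
    T = height (bitAt (f x))

  one⇒preimageOne : ∀ J → b J ≡ true → PreimageOne (f x) J
  one⇒preimageOne J bJ with first-return J bJ
  ... | e , 1+J<e , e≤J+N , Se≡SJ , above = f-one J bJ , e , ℕ.<-trans (ℕ.n<1+n J) 1+J<e , e≤J+N , ℤ.≤-reflexive (sym Te≡TJ)
    where
    J≤e : J ≤ e
    J≤e = ℕ.<⇒≤ (ℕ.<-trans (ℕ.n<1+n J) 1+J<e)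
    SJ≤ : ∀ s → J ≤ s → s < e → S J ℤ.≤ S (suc s)
    SJ≤ s J≤s s<e with ℕ.m≤n⇒m<n∨m≡n s<e
    ... | inj₁ 1+s<e = ℤ.<⇒≤ (above (suc s) (s≤s J≤s) 1+s<e)
    ... | inj₂ 1+s≡e = ℤ.≤-reflexive (sym (trans (cong S 1+s≡e) Se≡SJ))
    not-unmatched : ∀ s → J ≤ s → s < e → unmatched0 s ≡ false
    not-unmatched s J≤s s<e = ¬-not λ unmatched →
      unmatched⇒uncovered s unmatched (J , J≤s , ℕ.<-≤-trans s<e e≤J+N , SJ≤ s J≤s s<e)
    J+[e∸J]≡e : J + (e ∸ J) ≡ e
    J+[e∸J]≡e = ℕ.m+[n∸m]≡n J≤e
    T+S-constant : T e ℤ.+ S e ≡ T J ℤ.+ S J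
    T+S-constant = subst (λ t → T t ℤ.+ S t ≡ T J ℤ.+ S J) J+[e∸J]≡e
      (height-complementary b (bitAt (f x)) J (e ∸ J)
        (λ s J≤s s< → f-complement s (not-unmatched s J≤s (subst (s <_) J+[e∸J]≡e s<))))
    Te≡TJ : T e ≡ T J
    Te≡TJ = ∙-cancelʳ (S J) _ _ (trans (cong (λ w → T e ℤ.+ w) (sym Se≡SJ)) T+S-constant)

  module AfterUnmatchedZero (J : ℕ) (2n≤J : n + n ≤ J) (unmatchedJ : unmatched0 J ≡ true) where

    private
      a : ℕ
      a = suc J

      μ : ℕ → ℤ
      μ = rangeMin a

      μ≤Sa : ∀ L → μ L ℤ.≤ S a
      μ≤Sa L = subst (λ t → μ L ℤ.≤ S t) (ℕ.+-identityʳ a) (rangeMin-≤ a L 0 z≤n)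

    uncovered : ∀ s₀ → s₀ ≤ J → J < s₀ + N → S a ℤ.< S s₀
    uncovered s₀ s₀≤J J<s₀+N =
      ℤ.≰⇒> λ Ss₀≤Sa → unmatched⇒uncovered J unmatchedJ (s₀ , s₀≤J , J<s₀+N , Ss₀≤Sa)

    μ≤next : ∀ L → L < n → unmatched0 (a + L) ≡ false → μ L ℤ.≤ S (suc (a + L))
    μ≤next L L<n not-unmatched = cases (b s) refl
      where
      s = a + L
      2n≤s : n + n ≤ s
      2n≤s = ℕ.≤-trans 2n≤J (ℕ.≤-trans (ℕ.n≤1+n J) (ℕ.m≤m+n a L))
      μ≤Ss : μ L ℤ.≤ S s
      μ≤Ss = rangeMin-≤ a L L ℕ.≤-refl
      below-cover : Covered s → μ L ℤ.≤ S (suc s)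
      below-cover (s₀ , s₀≤s , s<s₀+N , Ss₀≤) = ℤ.≤-trans (μ≤Ss₀ (a ℕ.≤? s₀)) Ss₀≤
        where
        μ≤Ss₀ : Dec (a ≤ s₀) → μ L ℤ.≤ S s₀
        μ≤Ss₀ (yes a≤s₀) = subst (λ t → μ L ℤ.≤ S t) (ℕ.m+[n∸m]≡n a≤s₀)
          (rangeMin-≤ a L (s₀ ∸ a) (subst (s₀ ∸ a ≤_) (ℕ.m+n∸m≡n a L) (ℕ.∸-monoˡ-≤ a s₀≤s)))
        μ≤Ss₀ (no a≰s₀) = ℤ.≤-trans (μ≤Sa L) (ℤ.<⇒≤ (uncovered s₀ (ℕ.s≤s⁻¹ (ℕ.≰⇒> a≰s₀))
          (ℕ.<-trans (ℕ.<-≤-trans (ℕ.n<1+n J) (ℕ.m≤m+n a L)) s<s₀+N)))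
      cases : ∀ c → b s ≡ c → μ L ℤ.≤ S (suc s)
      cases true  bs = ℤ.≤-trans μ≤Ss (subst (S s ℤ.≤_) (cong (λ c → step c (S s)) (sym bs)) (ℤ.<⇒≤ (i<suc[i] (S s))))
      cases false bs = below-cover (matched0⇒covered s 2n≤s (not-unmatched-zero s bs not-unmatched))

    next<μ : ∀ L → L < n → unmatched0 (a + L) ≡ true → S (suc (a + L)) ℤ.< μ L
    next<μ L L<n unmatched with rangeMin-attained a L
    ... | l , l≤L , μ≡ = subst (S (suc s) ℤ.<_) (sym μ≡) (ℤ.≰⇒> λ Sa+l≤ →
          unmatched⇒uncovered s unmatched (a + l , ℕ.+-monoʳ-≤ a l≤L , s<a+l+N , Sa+l≤))
      where
      s = a + L
      s<a+l+N : s < a + l + N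
      s<a+l+N = ℕ.<-≤-trans (ℕ.+-monoʳ-< a (ℕ.<-trans L<n (ℕ.n<1+n n))) (ℕ.+-monoˡ-≤ N (ℕ.m≤m+n a l))

    -- Within a period after an unmatched zero, the unmatched zeros are exactly the new minima
    -- of S, so T + S − 2 · (running minimum of S) does not change.
    invariant : ∀ L → L ≤ n → T (a + L) ℤ.+ S (a + L) ℤ.+ S a ≡ T a ℤ.+ (μ L ℤ.+ μ L)
    invariant zero    _   = trans (cong (λ t → T t ℤ.+ S t ℤ.+ S a) (ℕ.+-identityʳ a)) (ℤ.+-assoc (T a) (S a) (S a))
    invariant (suc L) L<n = cases (unmatched0 s) refl
      where
      s = a + L
      IH = invariant L (ℕ.<⇒≤ L<n)
      unfold : T (a + suc L) ℤ.+ S (a + suc L) ℤ.+ S a ≡ T (suc s) ℤ.+ S (suc s) ℤ.+ S a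
      unfold = cong (λ t → T t ℤ.+ S t ℤ.+ S a) (ℕ.+-suc a L)
      μ′≡ : μ (suc L) ≡ μ L ℤ.⊓ S (suc s)
      μ′≡ = cong (λ t → μ L ℤ.⊓ S t) (ℕ.+-suc a L)
      cases : ∀ c → unmatched0 s ≡ c → T (a + suc L) ℤ.+ S (a + suc L) ℤ.+ S a ≡ T a ℤ.+ (μ (suc L) ℤ.+ μ (suc L))
      cases false not-unmatched = begin
        T (a + suc L) ℤ.+ S (a + suc L) ℤ.+ S a
          ≡⟨ unfold ⟩
        step (bitAt (f x) s) (T s) ℤ.+ step (b s) (S s) ℤ.+ S a
          ≡⟨ cong (λ c → step c (T s) ℤ.+ step (b s) (S s) ℤ.+ S a) (f-complement s not-unmatched) ⟩
        step (not (b s)) (T s) ℤ.+ step (b s) (S s) ℤ.+ S a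
          ≡⟨ cong (ℤ._+ S a) (step-complement (b s) (T s) (S s)) ⟩
        T s ℤ.+ S s ℤ.+ S a
          ≡⟨ IH ⟩
        T a ℤ.+ (μ L ℤ.+ μ L)
          ≡⟨ cong (λ m → T a ℤ.+ (m ℤ.+ m)) (trans μ′≡ (ℤ.i≤j⇒i⊓j≡i (μ≤next L L<n not-unmatched))) ⟨
        T a ℤ.+ (μ (suc L) ℤ.+ μ (suc L)) ∎
        where open ≡-Reasoning
      cases true unmatched = begin
        T (a + suc L) ℤ.+ S (a + suc L) ℤ.+ S a
          ≡⟨ unfold ⟩
        step (bitAt (f x) s) (T s) ℤ.+ step (b s) (S s) ℤ.+ S a
          ≡⟨ cong₂ (λ c c′ → step c (T s) ℤ.+ step c′ (S s) ℤ.+ S a) (f-unmatched s unmatched) bs≡false ⟩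
        predℤ (T s) ℤ.+ predℤ (S s) ℤ.+ S a
          ≡⟨ pred-+-pred-+ (T s) (S s) (S a) ⟩
        predℤ (predℤ (T s ℤ.+ S s ℤ.+ S a))
          ≡⟨ cong (λ r → predℤ (predℤ r)) IH ⟩
        predℤ (predℤ (T a ℤ.+ (μ L ℤ.+ μ L)))
          ≡⟨ +-pred-+-pred (T a) (μ L) ⟨
        T a ℤ.+ (predℤ (μ L) ℤ.+ predℤ (μ L))
          ≡⟨ cong (λ m → T a ℤ.+ (m ℤ.+ m)) μ′≡predμ ⟨
        T a ℤ.+ (μ (suc L) ℤ.+ μ (suc L)) ∎
        where
        open ≡-Reasoning
        bs≡false = proj₁ (unmatched-zero s unmatched)
        Ss′≡ : S (suc s) ≡ predℤ (S s)
        Ss′≡ = cong (λ c → step c (S s)) bs≡false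
        Ss′<μ = next<μ L L<n unmatched
        μ′≡predμ : μ (suc L) ≡ predℤ (μ L)
        μ′≡predμ = trans μ′≡ (trans (ℤ.i≥j⇒i⊓j≡j (ℤ.<⇒≤ Ss′<μ))
          (ℤ.≤-antisym (ℤ.i<j⇒i≤pred[j] Ss′<μ)
                       (subst (predℤ (μ L) ℤ.≤_) (sym Ss′≡) (ℤ.pred-mono (rangeMin-≤ a L L ℕ.≤-refl)))))

    T-drops : ∀ t → J < t → t ≤ J + N → T t ℤ.< T J
    T-drops t J<t t≤J+N = ℤ.≤-<-trans Tt≤Ta (subst (ℤ._< T J) (sym Ta≡) (pred[i]<i (T J)))
      where
      L = t ∸ a
      a+L≡t : a + L ≡ t
      a+L≡t = ℕ.m+[n∸m]≡n J<t
      L≤n : L ≤ n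
      L≤n = subst (L ≤_) (ℕ.m+n∸m≡n a n) (ℕ.∸-monoˡ-≤ a (subst (t ≤_) (ℕ.+-suc J n) t≤J+N))
      Ta≡ : T a ≡ predℤ (T J)
      Ta≡ = cong (λ c → step c (T J)) (f-unmatched J unmatchedJ)
      Tt≤Ta : T t ℤ.≤ T a
      Tt≤Ta = +-cancelʳ-≤ (S t ℤ.+ S a) (begin
        T t ℤ.+ (S t ℤ.+ S a)        ≡⟨ ℤ.+-assoc (T t) (S t) (S a) ⟨
        T t ℤ.+ S t ℤ.+ S a          ≡⟨ cong (λ r → T r ℤ.+ S r ℤ.+ S a) a+L≡t ⟨
        T (a + L) ℤ.+ S (a + L) ℤ.+ S a   ≡⟨ invariant L L≤n ⟩
        T a ℤ.+ (μ L ℤ.+ μ L)        ≤⟨ ℤ.+-monoʳ-≤ (T a) (ℤ.+-mono-≤ (subst (λ r → μ L ℤ.≤ S r) a+L≡t (rangeMin-≤ a L L ℕ.≤-refl)) (μ≤Sa L)) ⟩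
        T a ℤ.+ (S t ℤ.+ S a)        ∎)
        where open ℤ.≤-Reasoning

  preimageOne⇒one : ∀ J → n + n ≤ J → PreimageOne (f x) J → b J ≡ true
  preimageOne⇒one J 2n≤J (yJ≡false , t , J<t , t≤J+N , TJ≤Tt) = cases (b J) refl
    where
    cases : ∀ c → b J ≡ c → b J ≡ true
    cases true  bJ = bJ
    cases false bJ = ⊥-elim (ℤ.<-irrefl refl (ℤ.<-≤-trans (AfterUnmatchedZero.T-drops J 2n≤J unmatchedJ t J<t t≤J+N) TJ≤Tt))
      where
      unmatchedJ : unmatched0 J ≡ true
      unmatchedJ = cong₂ (λ c m → not c ∧ not m) bJ
        (trans (sym (trans (bitAt-f J) (cong (λ c → if c then false else matched0 x (J mod N)) bJ))) yJ≡false)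

f-injective : ∀ {n} {x x′ : Subset (suc n)} → Cyclic.S x (suc n) ℤ.< 0ℤ → Cyclic.S x′ (suc n) ℤ.< 0ℤ →
  f x ≡ f x′ → x ≡ x′
f-injective {n} {x} {x′} drift drift′ fx≡fx′ =
  trans (sym (tabulate∘lookup x)) (trans (tabulate-cong same-bit) (tabulate∘lookup x′))
  where
  bool-ext : ∀ {c c′} → (c ≡ true → c′ ≡ true) → (c′ ≡ true → c ≡ true) → c ≡ c′
  bool-ext {true}  {c′}    ⇒ _ = sym (⇒ refl)
  bool-ext {false} {true}  _ ⇐ = ⇐ refl
  bool-ext {false} {false} _ _ = refl
  same-bit : ∀ j → lookup x j ≡ lookup x′ j
  same-bit j = trans (sym (lifted x)) (trans (bool-ext (transfer x x′ drift drift′ fx≡fx′) (transfer x′ x drift′ drift (sym fx≡fx′))) (lifted x′))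
    where
    -- Any position ≡ j (mod N) would do; two periods up, the bound n + n ≤ t holds.
    t = toℕ j + 2 * suc n
    2n≤t : n + n ≤ t
    2n≤t = ℕ.≤-trans (ℕ.+-mono-≤ (ℕ.n≤1+n n) (subst (n ≤_) (sym (ℕ.+-identityʳ (suc n))) (ℕ.n≤1+n n)))
                     (ℕ.m≤n+m (2 * suc n) (toℕ j))
    lifted : ∀ v → bitAt v t ≡ lookup v j
    lifted v = trans (Cyclic.bitAt-+* v (toℕ j) 2) (Cyclic.bitAt-toℕ v j)
    transfer : ∀ v v′ → Cyclic.S v (suc n) ℤ.< 0ℤ → Cyclic.S v′ (suc n) ℤ.< 0ℤ → f v ≡ f v′ →
      bitAt v t ≡ true → bitAt v′ t ≡ true
    transfer v v′ d d′ fv≡fv′ one = Injectivity.preimageOne⇒one v′ d′ t 2n≤t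
      (subst (λ y → PreimageOne y t) fv≡fv′ (Injectivity.one⇒preimageOne v d t one))

-- Orbits of length one or two

nonempty-not-self-adjacent : ∀ {n} {x : Subset n} → 1 ≤ ∣ x ∣ → ¬ Adjacent x x
nonempty-not-self-adjacent {n} {x} 1≤∣x∣ x∩x-empty = ℕ.<-irrefl refl (ℕ.<-≤-trans 1≤∣x∣ (ℕ.≤-reflexive ∣x∣≡0))
  where
  ∣x∣≡0 : ∣ x ∣ ≡ 0
  ∣x∣≡0 = trans (cong ∣_∣ (Empty-unique (subst Empty (∩-idem x) x∩x-empty))) (∣⊥∣≡0 n)

module SparseString {n} (x : Subset (suc n)) (2∣x∣<N : ∣ x ∣ + ∣ x ∣ < suc n) where

  open Cyclic x

  drift : S N ℤ.< 0ℤ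
  drift = drift-negative x 2∣x∣<N

  open NegativeDrift x drift
  open UnmatchedZeros x drift

  f-disjoint : Adjacent x (f x)
  f-disjoint (i , i∈x∩fx) = true≢false (begin
    true                                                        ≡⟨ []=⇒lookup i∈x∩fx ⟨
    lookup (x ∩ f x) i                                          ≡⟨ lookup-zipWith _∧_ i x (f x) ⟩
    lookup x i ∧ lookup (f x) i                                 ≡⟨ cong (lookup x i ∧_) (lookup-f i) ⟩
    lookup x i ∧ (if lookup x i then false else matched0 x i)  ≡⟨ cases (lookup x i) (matched0 x i) ⟩
    false                                                       ∎)
    where
    open ≡-Reasoning
    cases : ∀ c m → c ∧ (if c then false else m) ≡ false
    cases true  m = refl
    cases false m = refl

  f-drift : Cyclic.S (f x) N ℤ.< 0ℤ
  f-drift = drift-negative (f x) (subst (λ k → k + k < N) (sym ∣f∣≡∣∣) 2∣x∣<N)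

  matched-before-unmatched : 1 ≤ ∣ x ∣ → ∃ λ u → unmatched0 u ≡ false × unmatched0 (suc u) ≡ true
  matched-before-unmatched 1≤∣x∣ with countTrue-pos b N (subst (1 ≤_) (∣∣≡countTrue-bitAt x) 1≤∣x∣)
                                    | countTrue-pos unmatched0 N 1≤U
    where
    1≤U : 1 ≤ unmatchedCount
    1≤U = ℕ.+-cancelʳ-< (∣ x ∣) 0 unmatchedCount
            (subst (∣ x ∣ <_) (sym unmatchedCount+∣∣≡zeros) (∣∣<zeros x 2∣x∣<N))
  ... | w , w<N , bw | z , _ , unmatched-z =
    rising-edge unmatched0 w (z + N ∸ w) (cong (λ c → not c ∧ not (matched0 x (w mod N))) bw)
      (trans (cong unmatched0 (ℕ.m+[n∸m]≡n (ℕ.≤-trans (ℕ.<⇒≤ w<N) (ℕ.m≤n+m N z))))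
             (trans (unmatched0-+N z) unmatched-z))

  f²-one : 2 ≤ N → ∀ u → unmatched0 u ≡ false → unmatched0 (suc u) ≡ true → bitAt (f (f x)) (suc u) ≡ true
  f²-one 2≤N u not-unmatched-u unmatched-u+1 =
    trans (NegativeDrift.bitAt-f (f x) f-drift (suc u))
      (trans (cong (λ c → if c then false else matched0 (f x) (suc u mod N)) yu+1)
             (Cyclic.covered⇒matched0 (f x) (suc u) yu+1 (Cyclic.rise-fall⇒covered (f x) 2≤N u yu yu+1)))
    where
    bu+1 = proj₁ (unmatched-zero (suc u) unmatched-u+1)
    bu≡false : b u ≡ false
    bu≡false = ¬-not λ bu → unmatched⇒uncovered (suc u) unmatched-u+1 (rise-fall⇒covered 2≤N u bu bu+1)
    yu : bitAt (f x) u ≡ true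
    yu = trans (f-complement u not-unmatched-u) (cong not bu≡false)
    yu+1 : bitAt (f x) (suc u) ≡ false
    yu+1 = f-unmatched (suc u) unmatched-u+1

  f²≢id : 1 ≤ ∣ x ∣ → f (f x) ≢ x
  f²≢id 1≤∣x∣ f²x≡x =
    let (u , not-unmatched-u , unmatched-u+1) = matched-before-unmatched 1≤∣x∣ in
    true≢false (trans (sym (f²-one 2≤N u not-unmatched-u unmatched-u+1))
                      (trans (cong (λ v → bitAt v (suc u)) f²x≡x) (proj₁ (unmatched-zero (suc u) unmatched-u+1))))
    where
    2≤N : 2 ≤ N
    2≤N = ℕ.<⇒≤ (ℕ.≤-<-trans (ℕ.+-mono-≤ 1≤∣x∣ 1≤∣x∣) 2∣x∣<N)

  period≥3 : 1 ≤ ∣ x ∣ → ∀ {p} → 1 ≤ p → iter f p x ≡ x → p ≥ 3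
  period≥3 1≤∣x∣ {1} _ fx≡x  = ⊥-elim (nonempty-not-self-adjacent 1≤∣x∣ (subst (Adjacent x) fx≡x f-disjoint))
  period≥3 1≤∣x∣ {2} _ f²x≡x = ⊥-elim (f²≢id 1≤∣x∣ f²x≡x)
  period≥3 _ {suc (suc (suc p))} _ _ = s≤s (s≤s (s≤s z≤n))

-- Orbits of injective maps on finite sets

least-witness : ∀ {Q : ℕ → Set} → Decidable Q → ∀ {q} → Q q → ∃ λ p → Q p × (∀ p′ → p′ < p → ¬ Q p′)
least-witness {Q} Q? {q} Qq = search q 0 (λ _ ()) Qq
  where
  search : ∀ d s → (∀ p′ → p′ < s → ¬ Q p′) → Q (s + d) → ∃ λ p → Q p × (∀ p′ → p′ < p → ¬ Q p′)
  search d s below Qs+d with Q? s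
  ... | yes Qs = s , Qs , below
  search zero    s below Qs+d | no ¬Qs = ⊥-elim (¬Qs (subst Q (ℕ.+-identityʳ s) Qs+d))
  search (suc d) s below Qs+d | no ¬Qs = search d (suc s) below′ (subst Q (ℕ.+-suc s d) Qs+d)
    where
    below′ : ∀ p′ → p′ < suc s → ¬ Q p′
    below′ p′ p′<1+s with ℕ.m≤n⇒m<n∨m≡n (ℕ.s≤s⁻¹ p′<1+s)
    ... | inj₁ p′<s = below p′ p′<s
    ... | inj₂ refl = ¬Qs

module Orbit {A : Set} {m : ℕ} (encode : A → Fin m) (encode-injective : ∀ {a b} → encode a ≡ encode b → a ≡ b)
             (g : A → A) (P : A → Set) (g-preserves : ∀ {a} → P a → P (g a))
             (g-injective : ∀ {a b} → P a → P b → g a ≡ g b → a ≡ b) where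

  iter-preserves : ∀ {a} → P a → ∀ i → P (iter g i a)
  iter-preserves Pa zero    = Pa
  iter-preserves Pa (suc i) = g-preserves (iter-preserves Pa i)

  iter-cancel : ∀ {a} → P a → ∀ i j k → iter g (i + j) a ≡ iter g (i + k) a → iter g j a ≡ iter g k a
  iter-cancel Pa zero    j k eq = eq
  iter-cancel Pa (suc i) j k eq =
    iter-cancel Pa i j k (g-injective (iter-preserves Pa (i + j)) (iter-preserves Pa (i + k)) eq)

  return-to-start : ∀ {a} → P a → ∀ {i j} → i < j → iter g i a ≡ iter g j a → iter g (j ∸ i) a ≡ a
  return-to-start {a} Pa {i} {j} i<j eq = sym (iter-cancel Pa i 0 (j ∸ i)
    (subst₂ (λ u v → iter g u a ≡ iter g v a) (sym (ℕ.+-identityʳ i)) (sym (ℕ.m+[n∸m]≡n (ℕ.<⇒≤ i<j))) eq))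

  Period : A → ℕ → Set
  Period a p = 1 ≤ p × iter g p a ≡ a

  period? : ∀ a → Decidable (Period a)
  period? a p with 1 ℕ.≤? p | encode (iter g p a) ≟ᶠ encode a
  ... | yes 1≤p | yes same = yes (1≤p , encode-injective same)
  ... | no  1≰p | _        = no (λ period → 1≰p (proj₁ period))
  ... | _       | no  diff = no (λ period → diff (cong encode (proj₂ period)))

  has-period : ∀ {a} → P a → ∃ (Period a)
  has-period {a} Pa with pigeonhole (ℕ.n<1+n m) (λ i → encode (iter g (toℕ i) a))
  ... | i , j , i<j , same = toℕ j ∸ toℕ i , ℕ.m<n⇒0<n∸m i<j , return-to-start Pa i<j (encode-injective same)

  orbit-is-cycle : ∀ {a} → P a →
    ∃ λ p → Period a p × (∀ i j → i < p → j < p → i ≢ j → iter g i a ≢ iter g j a)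
  orbit-is-cycle {a} Pa with least-witness (period? a) (proj₂ (has-period Pa))
  ... | p , period , minimal = p , period , distinct
    where
    no-return : ∀ {i j} → i < j → j < p → iter g i a ≢ iter g j a
    no-return {i} {j} i<j j<p eq =
      minimal (j ∸ i) (ℕ.≤-<-trans (ℕ.m∸n≤m j i) j<p) (ℕ.m<n⇒0<n∸m i<j , return-to-start Pa i<j eq)
    distinct : ∀ i j → i < p → j < p → i ≢ j → iter g i a ≢ iter g j a
    distinct i j i<p j<p i≢j with ℕ.<-cmp i j
    ... | tri< i<j _ _ = no-return i<j j<p
    ... | tri≈ _ i≡j _ = ⊥-elim (i≢j i≡j)
    ... | tri> _ _ j<i = λ eq → no-return j<i i<p (sym eq)

bitFin : Bool → Fin 2
bitFin false = fzero
bitFin true  = fsuc fzero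

bitFin-injective : ∀ {c c′} → bitFin c ≡ bitFin c′ → c ≡ c′
bitFin-injective {false} {false} _ = refl
bitFin-injective {true}  {true}  _ = refl

encode : ∀ {n} → Subset n → Fin (2 ^ n)
encode x = funToFin (λ i → bitFin (lookup x i))

encode-injective : ∀ {n} {x y : Subset n} → encode x ≡ encode y → x ≡ y
encode-injective {x = x} {y} same =
  trans (sym (tabulate∘lookup x)) (trans (tabulate-cong same-bit) (tabulate∘lookup y))
  where
  same-bit : ∀ i → lookup x i ≡ lookup y i
  same-bit i = bitFin-injective (begin
    bitFin (lookup x i)       ≡⟨ finToFun-funToFin (λ j → bitFin (lookup x j)) i ⟨
    finToFun (encode x) i     ≡⟨ cong (λ c → finToFun c i) same ⟩
    finToFun (encode y) i     ≡⟨ finToFun-funToFin (λ j → bitFin (lookup y j)) i ⟩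
    bitFin (lookup y i)       ∎)
    where open ≡-Reasoning

weight⇒sparse : ∀ {N k} (v : Subset N) → 2 * k + 1 ≤ N → ∣ v ∣ ≡ k → ∣ v ∣ + ∣ v ∣ < N
weight⇒sparse {N} {k} v 2k+1≤N refl =
  subst (_≤ N) (trans (ℕ.+-comm (2 * k) 1) (cong (λ m → suc (k + m)) (ℕ.+-identityʳ k))) 2k+1≤N

lemma7 : (n k : ℕ) → 1 ≤ k → n ≥ 2 * k + 1 → (x : Subset n) → InX n k x →
    ∃ λ (p : ℕ) → p ≥ 3 × iter f p x ≡ x
    × (∀ i j → i < p → j < p → i ≢ j → iter f i x ≢ iter f j x)
    × (∀ i → i < p → InX n k (iter f i x))
    × (∀ i → i < p → Adjacent (iter f i x) (iter f (1 + i) x))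
lemma7 zero    k 1≤k 2k+1≤0 = ⊥-elim (ℕ.<-irrefl refl (ℕ.≤-trans (ℕ.m≤n+m 1 (2 * k)) 2k+1≤0))
lemma7 (suc n) k 1≤k 2k+1≤N x ∣x∣≡k =
  let (p , (1≤p , returns) , distinct) = orbit-is-cycle ∣x∣≡k in
  p , SparseString.period≥3 x (sparse x ∣x∣≡k) (subst (1 ≤_) (sym ∣x∣≡k) 1≤k) 1≤p returns ,
  returns , distinct ,
  (λ i _ → iter-preserves ∣x∣≡k i) ,
  (λ i _ → SparseString.f-disjoint (iter f i x) (sparse (iter f i x) (iter-preserves ∣x∣≡k i)))
  where
  sparse : ∀ v → ∣ v ∣ ≡ k → ∣ v ∣ + ∣ v ∣ < suc n
  sparse v = weight⇒sparse v 2k+1≤N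
  drift : ∀ v → ∣ v ∣ ≡ k → Cyclic.S v (suc n) ℤ.< 0ℤ
  drift v ∣v∣≡k = drift-negative v (sparse v ∣v∣≡k)
  open Orbit encode encode-injective f (λ v → ∣ v ∣ ≡ k)
    (λ {v} ∣v∣≡k → trans (UnmatchedZeros.∣f∣≡∣∣ v (drift v ∣v∣≡k)) ∣v∣≡k)
    (λ {v} {w} ∣v∣≡k ∣w∣≡k → f-injective (drift v ∣v∣≡k) (drift w ∣w∣≡k))
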